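{- Let $k\ge2$, let $G_1=(V_1,E_1)$, $G_2=(V_2,E_2)$ be undirected graphs, $u,v\in V_1$, $u',v'\in V_2$. If there is a $\mathcal{W}_k$ formula $\varphi(x,y)$ of quantifier depth $m$ that distinguishes $(u,v)$ from $(u',v')$ (i.e. $\varphi$ holds in $G_1$ under $x\mapsto u,y\mapsto v$ exactly if it fails in $G_2$ under $x\mapsto u',y\mapsto v'$), then the bijective $k$-walk pebble game distinguishes $(u,v)$ from $(u',v')$ in $m$ rounds.
   Context: The logic $\mathcal{W}_k$ uses $k+1$ variables; formulas with free variables among $z_1,z_{k+1}$ are given by $\varphi(z_1,z_{k+1})::= z_1=z_{k+1}\mid z_1\sim z_{k+1}\mid\varphi\wedge\varphi\mid\neg\varphi\mid\exists^j(z_2,\dots,z_k).\ \bigwedge_{i\in[k]}\varphi_i(z_i,z_{i+1})$ with $z_1,\dots,z_{k+1}$ pairwise distinct variables; the walk quantifier holds iff at least $j$ distinct tuples $(v_2,\dots,v_k)$ satisfy the conjunction; quantifier depth is nesting depth of walk quantifiers. Bijective $k$-walk pebble game on $G_1,G_2$: there are pebble pairs $(p_i,q_i)$, $i\in[k+1]$; pairs $i,i+1$ ($i\in[k]$) and $k+1,1$ are consecutive. If $|V_1|\ne|V_2|$ Spoiler wins immediately. Each round: (1) if pebbles are on the graphs, Spoiler chooses a pair $(p_i,q_i)$ and relabels it as $(p_1,q_1)$, and relabels the next consecutive pair, if placed, as $(p_{k+1},q_{k+1})$; she then removes all pebble pairs except the first and last; (2) Duplicator chooses a bijection $f\colon V_1^{k-1}\to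 V_2^{k-1}$; (3) Spoiler chooses $(u_2,\dots,u_k)\in V_1^{k-1}$, puts $p_i$ on $u_i$ and $q_i$ on $v_i$ where $f(u_2,\dots,u_k)=(v_2,\dots,v_k)$. Spoiler wins after a round if some consecutive pebble pairs are placed on $(a,b)\in V_1^2$ (by $p$-pebbles) and $(a',b')\in V_2^2$ (by the corresponding $q$-pebbles) such that $G_1[\{a,b\}]$ and $G_2[\{a',b'\}]$ are not isomorphic via $a\mapsto a',b\mapsto b'$. The game distinguishes $(u,v)$ from $(u',v')$ in $m$ rounds if, in the modified game where $(p_1,q_1)$ starts on $(u,u')$ and $(p_{k+1},q_{k+1})$ on $(v,v')$ and the first round begins with Duplicator's move, Spoiler can ensure a win after at most $m$ rounds whatever Duplicator does; additionally, it distinguishes them in $0$ rounds if $(u,v)$ and $(u',v')$ are not of the same type among loop, edge, non-edge. -}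

module Defs where

open import Data.Nat using (ℕ; zero; suc; pred; _⊔_; _≤ᵇ_)
open import Data.Bool using (Bool; true; false; not; _∧_; if_then_else_)
open import Data.Fin using (Fin; zero; suc; inject₁; _≟_)
open import Data.Vec using (Vec; []; _∷_; _∷ʳ_; lookup; [_])
open import Data.List using (List; length; map; foldr; concatMap; allFin; filterᵇ)
open import Data.Bool.ListAction using (and)
import Data.List as L
open import Data.Product using (Σ; Σ-syntax; _×_; _,_)
open import Data.Sum using (_⊎_)
open import Relation.Nullary using (¬_; ⌊_⌋)
open import Relation.Binary.PropositionalEquality using (_≡_; _≢_)
open import Function.Bundles using (_⤖_; Bijection)

record Graph : Set where
  field
    n      : ℕ
    adj    : Fin n → Fin n → Bool
    sym    : ∀ a b → adj a b ≡ adj b a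
    irrefl : ∀ a → adj a a ≡ false

open Graph public

V : Graph → Set
V G = Fin (n G)

-- Syntax of W_k formulas φ(z₁, z_{k+1}).
-- walk j φs  is  ∃^j (z₂,…,z_k). ⋀_{i ∈ [k]} φs i (z_i, z_{i+1}),
-- where the k conjuncts are indexed by Fin k (index i ↦ conjunct i+1).

data Form (k : ℕ) : Set where
  eqF  : Form k                          -- z₁ = z_{k+1}
  adjF : Form k                          -- z₁ ∼ z_{k+1}
  _∧F_ : Form k → Form k → Form k
  ¬F_  : Form k → Form k
  walk : ℕ → (Fin k → Form k) → Form k

depth : ∀ {k} → Form k → ℕ
depth eqF = 0
depth adjF = 0
depth (φ ∧F ψ) = depth φ ⊔ depth ψ
depth (¬F φ) = depth φ
depth {k} (walk j φs) = suc (foldr _⊔_ 0 (map (λ i → depth (φs i)) (allFin k)))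

Tuple : Graph → ℕ → Set
Tuple G k = Vec (V G) (pred k)

-- the walk v₁ v₂ … v_k v_{k+1} with v₁ = a, v_{k+1} = b
-- (the case k = 0 is irrelevant: the paper assumes k ≥ 2)
walkSeq : ∀ {A : Set} k → A → Vec A (pred k) → A → Vec A (suc k)
walkSeq zero    a t b = [ a ]
walkSeq (suc m) a t b = a ∷ (t ∷ʳ b)

allTuples : ∀ n m → List (Vec (Fin n) m)
allTuples n zero    = [] L.∷ L.[]
allTuples n (suc m) = concatMap (λ x → map (x ∷_) (allTuples n m)) (allFin n)

-- Semantics: ⟦ φ ⟧ G a b  is the truth value of φ under z₁ ↦ a, z_{k+1} ↦ b.

⟦_⟧ : ∀ {k} → Form k → (G : Graph) → V G → V G → Bool
⟦ eqF ⟧ G a b = ⌊ a ≟ b ⌋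
⟦ adjF ⟧ G a b = adj G a b
⟦ φ ∧F ψ ⟧ G a b = ⟦ φ ⟧ G a b ∧ ⟦ ψ ⟧ G a b
⟦ ¬F φ ⟧ G a b = not (⟦ φ ⟧ G a b)
⟦_⟧ {k} (walk j φs) G a b =
  j ≤ᵇ length (filterᵇ
    (λ t → and (map (λ i → ⟦ φs i ⟧ G (lookup (walkSeq k a t b) (inject₁ i))
                                       (lookup (walkSeq k a t b) (suc i)))
                    (allFin k)))
    (allTuples (n G) (pred k)))

data AtType : Set where
  loop edge nonedge : AtType

atp : (G : Graph) → V G → V G → AtType
atp G a b = if ⌊ a ≟ b ⌋ then loop else (if adj G a b then edge else nonedge)

-- G₁[{a,b}] ≅ G₂[{a',b'}] via a ↦ a', b ↦ b'  (simple graphs):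
-- the map is a well-defined bijection and preserves (non-)adjacency.
PartIso : (G₁ G₂ : Graph) → V G₁ → V G₁ → V G₂ → V G₂ → Set
PartIso G₁ G₂ a b a' b' =
  ((a ≡ b → a' ≡ b') × (a' ≡ b' → a ≡ b)) × (adj G₁ a b ≡ adj G₂ a' b')

-- Cyclic successor on pebble indices: pair i is followed by pair i+1,
-- and the last pair (k+1) is followed by the first.

next : ∀ {m} → Fin (suc m) → Fin (suc m)
next {zero} zero = zero
next {suc m} zero = suc zero
next {suc m} (suc i) with next {m} i
... | zero  = zero
... | suc j = suc (suc j)

-- Dist G₁ G₂ k m a b a' b' : in the bijective k-walk pebble game, with
-- (p₁,q₁) on (a,a') and (p_{k+1},q_{k+1}) on (b,b') and the first round
-- starting with Duplicator's move, Spoiler can ensure a win after at most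
-- m rounds.

data Dist (G₁ G₂ : Graph) (k : ℕ) : ℕ → V G₁ → V G₁ → V G₂ → V G₂ → Set where
  sizeDiff : ∀ {m a b a' b'} → n G₁ ≢ n G₂ → Dist G₁ G₂ k m a b a' b'
  atomic   : ∀ {m a b a' b'} → atp G₁ a b ≢ atp G₂ a' b' → Dist G₁ G₂ k m a b a' b'
  -- one round: for every bijection f chosen by Duplicator, Spoiler picks ū;
  -- then either some consecutive pebble pairs witness a non-isomorphism
  -- (Spoiler wins after this round), or Spoiler chooses a pair i, relabels it
  -- as pair 1 and its successor as pair k+1, and wins within m more rounds.
  round    : ∀ {m a b a' b'} →
    ((f : Tuple G₁ k ⤖ Tuple G₂ k) →
      Σ[ ū ∈ Tuple G₁ k ]
        (let w  = walkSeq k a ū b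
             w' = walkSeq k a' (Bijection.to f ū) b'
         in (Σ[ i ∈ Fin (suc k) ]
               ¬ PartIso G₁ G₂ (lookup w i) (lookup w (next i))
                               (lookup w' i) (lookup w' (next i)))
            ⊎ (Σ[ i ∈ Fin (suc k) ]
               Dist G₁ G₂ k m (lookup w i) (lookup w (next i))
                              (lookup w' i) (lookup w' (next i))))) →
    Dist G₁ G₂ k (suc m) a b a' b'

-- Atomic formulas are determined by the atomic type of the pair, and
-- a conjunction or negation inherits a distinguishing subformula. For φ = ∃^j (z₂,…,z_k). ⋀ φᵢ,
-- the two graphs have different numbers of tuples satisfying the conjunction. A bijection f
-- preserving the conjunction value would preserve that number, so for Duplicator's f some tuple ū
-- has conjunction value different from that of f ū, and some conjunct φᵢ separates the
-- consecutive pebble pairs i, i+1. Spoiler picks ū and continues from those two pairs with the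
-- strategy for φᵢ.
module Submission where

open import Defs hiding (sym)
open import Data.Nat using (ℕ; suc; pred; _≤_; _<_; s≤s⁻¹; _⊔_; _≤ᵇ_; s≤s)
open import Data.Nat.Properties using (≤-reflexive; m≤n⇒m≤n⊔o; m≤n⇒m≤o⊔n; m≤m⊔n; m≤n⊔m)
open import Data.Bool using (Bool; true; false; not; _∧_; if_then_else_; T?)
open import Data.Bool.Properties using (not-¬) renaming (_≟_ to _≟ᵇ_)
open import Data.Fin using (Fin; zero; suc; inject₁; _≟_)
open import Data.Vec using (Vec; _∷_; lookup)
open import Data.Vec.Properties using (∷-injective)
open import Data.List using (List; []; _∷_; length; map; foldr; concatMap; allFin; filterᵇ; cartesianProductWith; _++_)
open import Data.List.Properties using (length-map; map-cong; foldr-preservesᵒ)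
open import Data.Bool.ListAction using (and)
open import Data.List.Membership.Propositional using (_∈_)
open import Data.List.Membership.Propositional.Properties using (∈-map⁺; ∈-allFin; ∈-cartesianProductWith⁺)
open import Data.List.Membership.Propositional.Properties.WithK using (unique∧set⇒bag)
open import Data.List.Relation.Binary.BagAndSetEquality using (∼bag⇒↭)
open import Data.List.Relation.Binary.Permutation.Propositional using (_↭_)
open import Data.List.Relation.Binary.Permutation.Propositional.Properties using (↭-length; filter-↭)
open import Data.List.Relation.Unary.Unique.Propositional using (Unique)
import Data.List.Relation.Unary.Unique.Propositional.Properties as Unique
open import Data.List.Relation.Unary.Any as Any using (here; any?)
open import Data.List.Relation.Unary.All as All using ()
open import Data.List.Relation.Unary.All.Properties using (¬Any⇒All¬)
open import Data.List.Relation.Unary.AllPairs using ([]; _∷_)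
open import Data.Product using (∃-syntax; _×_; _,_; proj₁; proj₂)
import Data.Product as Product
open import Data.Sum using ([_,_]; inj₂)
import Data.Sum as Sum
open import Relation.Nullary using (¬_; ⌊_⌋; yes; no; ¬?; contradiction)
open import Relation.Nullary.Decidable using (decidable-stable)
open import Relation.Binary.PropositionalEquality using (_≡_; _≢_; refl; sym; trans; cong; cong₂; subst)
open import Function using (_∘_; flip)
open import Function.Bundles using (_⤖_; Bijection; mk⇔)

private
  variable
    A B C : Set

∈⇒≤foldr-⊔ : ∀ {x xs} → x ∈ xs → x ≤ foldr _⊔_ 0 xs
∈⇒≤foldr-⊔ {xs = xs} x∈xs =
  foldr-preservesᵒ (λ y z → [ m≤n⇒m≤n⊔o z , m≤n⇒m≤o⊔n y ]) 0 xs (inj₂ (Any.map ≤-reflexive x∈xs))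

IsEnumeration : List A → Set
IsEnumeration xs = Unique xs × (∀ x → x ∈ xs)

¬∀≡⇒∃≢ : ∀ {xs : List A} → (∀ x → x ∈ xs) → (g h : A → Bool) →
         ¬ (∀ x → g x ≡ h x) → ∃[ x ] g x ≢ h x
¬∀≡⇒∃≢ {xs = xs} complete g h ¬g≗h with any? (λ x → ¬? (g x ≟ᵇ h x)) xs
... | yes some = Any.satisfied some
... | no none  = contradiction g≗h ¬g≗h
  where
  g≗h : ∀ x → g x ≡ h x
  g≗h x = decidable-stable (g x ≟ᵇ h x) (All.lookup (¬Any⇒All¬ xs none) (complete x))

map-filterᵇ : (f : A → B) {p : A → Bool} {q : B → Bool} → (∀ x → p x ≡ q (f x)) →
              ∀ xs → map f (filterᵇ p xs) ≡ filterᵇ q (map f xs)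
map-filterᵇ f         p≡q∘f []       = refl
map-filterᵇ f {p} {q} p≡q∘f (x ∷ xs) rewrite sym (p≡q∘f x) with p x
... | true  = cong (f x ∷_) (map-filterᵇ f p≡q∘f xs)
... | false = map-filterᵇ f p≡q∘f xs

-- A bijection carries an enumeration of A to a permutation of any enumeration of B.
length-filterᵇ-⤖ : (f : A ⤖ B) {p : A → Bool} {q : B → Bool} →
                   (∀ x → p x ≡ q (Bijection.to f x)) →
                   ∀ {xs ys} → IsEnumeration xs → IsEnumeration ys →
                   length (filterᵇ p xs) ≡ length (filterᵇ q ys)
length-filterᵇ-⤖ f {p} {q} p≡q∘f {xs} {ys} (xs-unique , xs-complete) (ys-unique , ys-complete) =
  trans (sym (length-map to (filterᵇ p xs)))
        (trans (cong length (map-filterᵇ to p≡q∘f xs))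
               (↭-length (filter-↭ (T? ∘ q) map-to-xs↭ys)))
  where
  open Bijection f using (to; injective; strictlySurjective)
  ∈-map-to-xs : ∀ y → y ∈ map to xs
  ∈-map-to-xs y with strictlySurjective y
  ... | x , refl = ∈-map⁺ to (xs-complete x)
  map-to-xs↭ys : map to xs ↭ ys
  map-to-xs↭ys = ∼bag⇒↭ (unique∧set⇒bag (Unique.map⁺ injective xs-unique) ys-unique
                           (λ {y} → mk⇔ (λ _ → ys-complete y) (λ _ → ∈-map-to-xs y)))

concatMap-map≡cartesianProductWith : (g : A → B → C) (xs : List A) (ys : List B) →
  concatMap (λ x → map (g x) ys) xs ≡ cartesianProductWith g xs ys
concatMap-map≡cartesianProductWith g []       ys = refl
concatMap-map≡cartesianProductWith g (x ∷ xs) ys =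
  cong (map (g x) ys ++_) (concatMap-map≡cartesianProductWith g xs ys)

allTuples-isEnumeration : ∀ n m → IsEnumeration (allTuples n m)
allTuples-isEnumeration n 0       = (All.[] ∷ []) , λ { Vec.[] → here refl }
allTuples-isEnumeration n (suc m) with allTuples-isEnumeration n m
... | unique , complete =
  subst IsEnumeration (sym (concatMap-map≡cartesianProductWith _∷_ (allFin n) (allTuples n m)))
    ( Unique.cartesianProductWith⁺ _∷_ ∷-injective (Unique.allFin⁺ n) unique
    , λ { (x ∷ t) → ∈-cartesianProductWith⁺ _∷_ (∈-allFin x) (complete t) })

Dist-mono : ∀ {G₁ G₂ k m m' a b a' b'} → m ≤ m' →
            Dist G₁ G₂ k m a b a' b' → Dist G₁ G₂ k m' a b a' b'
Dist-mono _           (sizeDiff n₁≢n₂) = sizeDiff n₁≢n₂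
Dist-mono _           (atomic atp≢)    = atomic atp≢
Dist-mono (s≤s m≤m') (round strategy) = round λ f →
  Product.map₂ (Sum.map₂ (Product.map₂ (Dist-mono m≤m'))) (strategy f)

next-inject₁ : ∀ {m} (i : Fin m) → next (inject₁ i) ≡ suc i
next-inject₁ {suc m} zero    = refl
next-inject₁ {suc m} (suc i) rewrite next-inject₁ i = refl

edgeType : Bool → AtType
edgeType c = if c then edge else nonedge

loop≢edgeType : ∀ c → loop ≢ edgeType c
loop≢edgeType true  ()
loop≢edgeType false ()

edgeType-injective : ∀ {c d} → edgeType c ≡ edgeType d → c ≡ d
edgeType-injective {true}  {true}  _ = refl
edgeType-injective {false} {false} _ = refl

atp-≡⇒≡-adj : ∀ {G₁ G₂} {a b : V G₁} {a' b' : V G₂} → atp G₁ a b ≡ atp G₂ a' b' →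
              ⌊ a ≟ b ⌋ ≡ ⌊ a' ≟ b' ⌋ × adj G₁ a b ≡ adj G₂ a' b'
atp-≡⇒≡-adj {G₁} {G₂} {a} {b} {a'} {b'} same with a ≟ b | a' ≟ b'
... | yes refl | yes refl = refl , trans (irrefl G₁ a) (sym (irrefl G₂ a'))
... | yes _    | no _     = contradiction same (loop≢edgeType (adj G₂ a' b'))
... | no _     | yes _    = contradiction (sym same) (loop≢edgeType (adj G₁ a b))
... | no _     | no _     = refl , edgeType-injective same

conjuncts : ∀ {k} → (Fin k → Form k) → (G : Graph) → V G → V G → Tuple G k → Fin k → Bool
conjuncts {k} φs G a b t i =
  ⟦ φs i ⟧ G (lookup (walkSeq k a t b) (inject₁ i)) (lookup (walkSeq k a t b) (suc i))

conjunction : ∀ {k} → (Fin k → Form k) → (G : Graph) → V G → V G → Tuple G k → Bool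
conjunction {k} φs G a b t = and (map (conjuncts φs G a b t) (allFin k))

depth-conjunct : ∀ {k} j (φs : Fin k → Form k) i → depth (φs i) < depth (walk j φs)
depth-conjunct j φs i =
  s≤s (∈⇒≤foldr-⊔ (∈-map⁺ (λ i → depth (φs i)) (∈-allFin i)))

module _ (G₁ G₂ : Graph) (k : ℕ) where

  ≢⟦⟧⇒Dist : (φ : Form k) → ∀ {a b a' b'} → ⟦ φ ⟧ G₁ a b ≢ ⟦ φ ⟧ G₂ a' b' →
             Dist G₁ G₂ k (depth φ) a b a' b'
  ≢⟦⟧⇒Dist eqF  φ≢ = atomic (φ≢ ∘ proj₁ ∘ atp-≡⇒≡-adj {G₁} {G₂})
  ≢⟦⟧⇒Dist adjF φ≢ = atomic (φ≢ ∘ proj₂ ∘ atp-≡⇒≡-adj {G₁} {G₂})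
  ≢⟦⟧⇒Dist (φ ∧F ψ) {a} {b} {a'} {b'} φ∧ψ≢ with ⟦ φ ⟧ G₁ a b ≟ᵇ ⟦ φ ⟧ G₂ a' b'
  ... | no φ≢  = Dist-mono (m≤m⊔n (depth φ) (depth ψ)) (≢⟦⟧⇒Dist φ φ≢)
  ... | yes φ≡ = Dist-mono (m≤n⊔m (depth φ) (depth ψ)) (≢⟦⟧⇒Dist ψ (φ∧ψ≢ ∘ cong₂ _∧_ φ≡))
  ≢⟦⟧⇒Dist (¬F φ) ¬φ≢ = ≢⟦⟧⇒Dist φ (¬φ≢ ∘ cong not)
  ≢⟦⟧⇒Dist (walk j φs) {a} {b} {a'} {b'} walk≢ =
    round λ f → let open Spoiler f in ū , inj₂ (inject₁ i , continue)
    where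
    module Spoiler (f : Tuple G₁ k ⤖ Tuple G₂ k) where
      to : Tuple G₁ k → Tuple G₂ k
      to = Bijection.to f
      ū-separates : ∃[ ū ] conjunction φs G₁ a b ū ≢ conjunction φs G₂ a' b' (to ū)
      ū-separates = ¬∀≡⇒∃≢ (proj₂ (allTuples-isEnumeration _ _))
        (conjunction φs G₁ a b) (conjunction φs G₂ a' b' ∘ to)
        (λ preserved → walk≢ (cong (j ≤ᵇ_) (length-filterᵇ-⤖ f preserved
          (allTuples-isEnumeration _ _) (allTuples-isEnumeration _ _))))
      ū : Tuple G₁ k
      ū = proj₁ ū-separates
      i-separates : ∃[ i ] conjuncts φs G₁ a b ū i ≢ conjuncts φs G₂ a' b' (to ū) i
      i-separates = ¬∀≡⇒∃≢ ∈-allFin _ _ (proj₂ ū-separates ∘ cong and ∘ flip map-cong (allFin k))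
      i : Fin k
      i = proj₁ i-separates
      w : Vec (V G₁) (suc k)
      w = walkSeq k a ū b
      w' : Vec (V G₂) (suc k)
      w' = walkSeq k a' (to ū) b'
      continue : Dist G₁ G₂ k (pred (depth (walk j φs)))
                   (lookup w (inject₁ i)) (lookup w (next (inject₁ i)))
                   (lookup w' (inject₁ i)) (lookup w' (next (inject₁ i)))
      continue rewrite next-inject₁ i =
        Dist-mono (s≤s⁻¹ (depth-conjunct j φs i)) (≢⟦⟧⇒Dist (φs i) (proj₂ i-separates))

lemma15 : (k : ℕ) → 2 ≤ k → (G₁ G₂ : Graph) (u v : V G₁) (u' v' : V G₂)
          (m : ℕ) (φ : Form k) → depth φ ≡ m →
          ⟦ φ ⟧ G₁ u v ≡ not (⟦ φ ⟧ G₂ u' v') →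
          Dist G₁ G₂ k m u v u' v'
lemma15 k _ G₁ G₂ u v u' v' m φ refl φ≡not = ≢⟦⟧⇒Dist G₁ G₂ k φ (flip not-¬ φ≡not)
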